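{- Every shortest path graph is $(K_4-e)$-free, i.e., contains no induced subgraph isomorphic to $K_4$ with one edge removed.
   Context: For a simple graph $G$ and distinct $a,b\in V(G)$, the shortest path graph $S(G,a,b)$ has as vertices the shortest $a$–$b$ paths in $G$, two being adjacent iff their vertex sets differ in exactly one vertex. A shortest path graph is any graph isomorphic to some $S(G,a,b)$. -}

module Defs where

open import Data.Nat using (ℕ; _≤_)
open import Data.List using (List; length; head; last)
open import Data.Maybe using (just)
open import Data.Product using (Σ; _×_; ∃; _,_; proj₁)
open import Data.Empty using (⊥)
open import Relation.Nullary using (¬_)
open import Relation.Binary.PropositionalEquality using (_≡_; _≢_)
open import Data.List.Relation.Unary.Linked using (Linked)
open import Data.List.Relation.Unary.Unique.Propositional using (Unique)
open import Data.List.Membership.Propositional using (_∈_; _∉_)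

record SimpleGraph (V : Set) : Set₁ where
  field
    Adj     : V → V → Set
    symAdj  : ∀ {x y} → Adj x y → Adj y x
    irrAdj  : ∀ {x} → ¬ Adj x x

open SimpleGraph public

record IsPath {V : Set} (G : SimpleGraph V) (a b : V) (P : List V) : Set where
  field
    startsAt  : head P ≡ just a
    endsAt    : last P ≡ just b
    adjacent  : Linked (Adj G) P
    distinct  : Unique P

record IsShortestPath {V : Set} (G : SimpleGraph V) (a b : V) (P : List V) : Set where
  field
    isPath   : IsPath G a b P
    minimal  : ∀ Q → IsPath G a b Q → length P ≤ length Q

SPVertex : {V : Set} → SimpleGraph V → V → V → Set
SPVertex {V} G a b = Σ (List V) (IsShortestPath G a b)

ExactlyOneOutside : {V : Set} → List V → List V → Set
ExactlyOneOutside {V} P Q =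
  Σ V (λ x → (x ∈ P × x ∉ Q) × (∀ y → y ∈ P → y ∉ Q → y ≡ x))

DifferInOneVertex : {V : Set} → List V → List V → Set
DifferInOneVertex P Q = ExactlyOneOutside P Q × ExactlyOneOutside Q P

SPAdj : {V : Set} {G : SimpleGraph V} {a b : V} →
        SPVertex G a b → SPVertex G a b → Set
SPAdj (P , _) (Q , _) = DifferInOneVertex P Q

record InducedK4-e {W : Set} (_≈_ : W → W → Set) (R : W → W → Set) (u₁ u₂ u₃ u₄ : W) : Set where
  field
    d12 : ¬ (u₁ ≈ u₂)
    d13 : ¬ (u₁ ≈ u₃)
    d14 : ¬ (u₁ ≈ u₄)
    d23 : ¬ (u₂ ≈ u₃)
    d24 : ¬ (u₂ ≈ u₄)
    d34 : ¬ (u₃ ≈ u₄)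
    e12 : R u₁ u₂
    e13 : R u₁ u₃
    e14 : R u₁ u₄
    e23 : R u₂ u₃
    e24 : R u₂ u₄
    n34 : ¬ R u₃ u₄

K4-eFree : {W : Set} → (W → W → Set) → (W → W → Set) → Set
K4-eFree {W} _≈_ R = ∀ (u₁ u₂ u₃ u₄ : W) → ¬ InducedK4-e _≈_ R u₁ u₂ u₃ u₄

-- Identity of vertices of S(G,a,b): two shortest paths are the same vertex
-- iff they are the same path (same vertex list); proofs are irrelevant.
SPEq : {V : Set} {G : SimpleGraph V} {a b : V} →
       SPVertex G a b → SPVertex G a b → Set
SPEq p q = proj₁ p ≡ proj₁ q

SPGraphK4-eFree : {V : Set} → SimpleGraph V → V → V → Set
SPGraphK4-eFree G a b = K4-eFree (SPEq {G = G} {a} {b}) (SPAdj {G = G} {a} {b})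

module Submission where

-- Read a path as the sequence k ↦ (its k-th vertex).  The key fact is that in
-- shortest a–b paths every vertex v sits at a fixed position (its distance
-- from a): if v were strictly earlier on P than on Q, then either the part of
-- P before v avoids the part of Q after v, and splicing the two gives an a–b
-- path shorter than Q, or the two parts share a vertex w, which is then a
-- crossing of the same kind with a strictly shorter prefix; induct on it.
--
-- Consequently two adjacent vertices of S(G,a,b) (paths whose vertex sets
-- differ in exactly one vertex) differ as sequences in exactly one position,
-- and conversely.  In a triangle of such sequences the three differences lie
-- at the same position, so in a K₄ − e on u₁,u₂,u₃,u₄ the paths u₃ and u₄
-- both differ from u₁ only where u₂ does; hence they differ from each other
-- in one position only and are adjacent, a contradiction.
--
-- The vertex type carries no decidable equality, so equality facts between
-- entries are obtained only up to double negation; as the goal is ⊥, this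
-- suffices everywhere.

open import Defs
open import Relation.Binary.PropositionalEquality using (_≢_)

open import Data.Nat using (ℕ; zero; suc; _<_; s≤s; z≤n)
open import Data.Nat.Properties
  using (_≟_; suc-injective; ≤-antisym; <-trans; <-≤-trans; <⇒≱; <-cmp; +-monoˡ-<)
open import Data.Nat.Induction using (<-wellFounded)
open import Induction.WellFounded using (Acc; acc)
open import Data.List using (List; []; _∷_; _++_; length; head; last)
open import Data.List.Properties using (length-++; length-++-≤ˡ; ++-assoc)
open import Data.Maybe using (Maybe; just; nothing)
open import Data.Maybe.Properties using (just-injective)
open import Data.Product using (Σ; ∃; ∃₂; _×_; _,_; proj₁; proj₂)
open import Data.Empty using (⊥; ⊥-elim)
open import Relation.Nullary using (¬_; yes; no; ¬¬-excluded-middle)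
open import Relation.Binary.PropositionalEquality
  using (_≡_; refl; sym; trans; cong; cong₂; subst)
open import Relation.Binary.Definitions using (tri<; tri≈; tri>)
open import Data.List.Relation.Unary.Linked using (Linked; _∷_)
open import Data.List.Relation.Unary.All as All using (All; _∷_)
import Data.List.Relation.Unary.All.Properties as All
open import Data.List.Relation.Unary.Any using (here; there)
open import Data.List.Relation.Unary.AllPairs using (_∷_)
open import Data.List.Relation.Unary.Unique.Propositional using (Unique)
open import Data.List.Relation.Binary.Disjoint.Propositional using (Disjoint; contractₗ)
open import Data.List.Membership.Propositional using (_∈_; _∉_)
open import Data.List.Membership.Propositional.Properties using (∈-∃++)

private
  variable
    A : Set
    x y : A
    xs ys zs : List A
    i j : ℕ

module _ {A : Set} where

  AgreeOff : (ℕ → A) → (ℕ → A) → ℕ → Set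
  AgreeOff f g i = ∀ k → k ≢ i → ¬ ¬ (f k ≡ g k)

  DiffersOnlyAt : (ℕ → A) → (ℕ → A) → ℕ → Set
  DiffersOnlyAt f g i = f i ≢ g i × AgreeOff f g i

  agree-everywhere : ∀ {f g : ℕ → A} → AgreeOff f g i → f i ≡ g i →
                     ∀ k → ¬ ¬ (f k ≡ g k)
  agree-everywhere {i} ag fi≡gi k with k ≟ i
  ... | yes refl = λ ¬eq → ¬eq fi≡gi
  ... | no  k≢i  = ag k k≢i

  agree-through : ∀ {f g h : ℕ → A} → AgreeOff f g i → AgreeOff f h i →
                  AgreeOff g h i
  agree-through fg fh k k≢i ¬gh =
    fg k k≢i λ f≡g → fh k k≢i λ f≡h → ¬gh (trans (sym f≡g) f≡h)

  agree-sym : ∀ {f g : ℕ → A} → AgreeOff f g i → AgreeOff g f i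
  agree-sym ag k k≢i ¬gf = ag k k≢i λ f≡g → ¬gf (sym f≡g)

  -- In a triangle of one-position differences all three positions coincide:
  -- if g differs from f at i but h differs from f at j ≠ i, then g and h
  -- differ both at i and at j.
  triangle-same-position : ∀ {f g h : ℕ → A} {l} →
    DiffersOnlyAt f g i → DiffersOnlyAt f h j → DiffersOnlyAt g h l → j ≡ i
  triangle-same-position {i} {j} {l = l} (fi≢gi , fg) (fj≢hj , fh) (_ , gh)
    with j ≟ i
  ... | yes j≡i = j≡i
  ... | no  j≢i with i ≟ l
  ...   | no i≢l =
    ⊥-elim (fh i (λ i≡j → j≢i (sym i≡j)) λ fi≡hi →
            gh i i≢l λ gi≡hi → fi≢gi (trans fi≡hi (sym gi≡hi)))
  ...   | yes refl =
    ⊥-elim (fg j j≢i λ fj≡gj → gh j j≢i λ gj≡hj → fj≢hj (trans fj≡gj gj≡hj))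

at : List A → ℕ → Maybe A
at []       _       = nothing
at (x ∷ xs) zero    = just x
at (x ∷ xs) (suc k) = at xs k

at⇒∈ : ∀ (xs : List A) {k} → at xs k ≡ just x → x ∈ xs
at⇒∈ (y ∷ xs) {zero}  refl = here refl
at⇒∈ (y ∷ xs) {suc k} eq   = there (at⇒∈ xs eq)

∈⇒at : x ∈ xs → ∃ λ k → at xs k ≡ just x
∈⇒at (here refl) = zero , refl
∈⇒at (there x∈xs) with ∈⇒at x∈xs
... | k , eq = suc k , eq

at-injective : Unique xs → at xs i ≡ just x → at xs j ≡ just x → i ≡ j
at-injective {xs = y ∷ xs} {zero}  {j = zero}  _ _ _ = refl
at-injective {xs = y ∷ xs} {zero}  {j = suc j} (y∉ ∷ _) refl eq =
  ⊥-elim (All.lookup y∉ (at⇒∈ xs eq) refl)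
at-injective {xs = y ∷ xs} {suc i} {j = zero}  (y∉ ∷ _) eq refl =
  ⊥-elim (All.lookup y∉ (at⇒∈ xs eq) refl)
at-injective {xs = y ∷ xs} {suc i} {j = suc j} (_ ∷ u) eq eq′ =
  cong suc (at-injective u eq eq′)

at-beyond : ∀ (xs ys : List A) {k} → length xs ≡ length ys →
            at xs k ≡ nothing → at ys k ≡ nothing
at-beyond []       []       _   _  = refl
at-beyond (x ∷ xs) (y ∷ ys) {zero}  _ ()
at-beyond (x ∷ xs) (y ∷ ys) {suc k} len eq = at-beyond xs ys (suc-injective len) eq

split-at : ∀ (xs : List A) {k} → at xs k ≡ just x →
           ∃₂ λ ys zs → xs ≡ ys ++ x ∷ zs × length ys ≡ k
split-at (y ∷ xs) {zero}  refl = [] , xs , refl , refl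
split-at (y ∷ xs) {suc k} eq with split-at xs eq
... | ys , zs , refl , refl = y ∷ ys , zs , refl , refl

¬¬-list-ext : ∀ (xs ys : List A) → (∀ k → ¬ ¬ (at xs k ≡ at ys k)) →
              ¬ ¬ (xs ≡ ys)
¬¬-list-ext []       []       _  ¬eq = ¬eq refl
¬¬-list-ext []       (y ∷ ys) ag _   = ag 0 λ ()
¬¬-list-ext (x ∷ xs) []       ag _   = ag 0 λ ()
¬¬-list-ext (x ∷ xs) (y ∷ ys) ag ¬eq =
  ag 0 λ x≡y → ¬¬-list-ext xs ys (λ k → ag (suc k)) λ xs≡ys →
    ¬eq (cong₂ _∷_ (just-injective x≡y) xs≡ys)

agree-off⇒differs-at : ∀ (xs ys : List A) → AgreeOff (at xs) (at ys) i →
                       xs ≢ ys → at xs i ≢ at ys i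
agree-off⇒differs-at xs ys ag xs≢ys eq =
  ¬¬-list-ext xs ys (agree-everywhere ag eq) xs≢ys

prefix-shorter : ∀ (xs : List A) → length xs < length (xs ++ y ∷ ys)
prefix-shorter []       = s≤s z≤n
prefix-shorter (x ∷ xs) = s≤s (prefix-shorter xs)

++-shorter : ∀ (xs ys : List A) {zs} → length xs < length ys →
             length (xs ++ zs) < length (ys ++ zs)
++-shorter xs ys {zs} lt
  rewrite length-++ xs {zs} | length-++ ys {zs} = +-monoˡ-< (length zs) lt

module _ {A : Set} {R : A → A → Set} where

  linked-suffix : ∀ (xs : List A) → Linked R (xs ++ x ∷ ys) → Linked R (x ∷ ys)
  linked-suffix []           l       = l
  linked-suffix (_ ∷ [])     (_ ∷ l) = l
  linked-suffix (_ ∷ _ ∷ xs) (_ ∷ l) = linked-suffix (_ ∷ xs) l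

  linked-splice : ∀ (xs : List A) → Linked R (xs ++ x ∷ ys) → Linked R (x ∷ zs) →
                  Linked R (xs ++ x ∷ zs)
  linked-splice []           _       l = l
  linked-splice (_ ∷ [])     (r ∷ _) l = r ∷ l
  linked-splice (_ ∷ _ ∷ xs) (r ∷ l) l′ = r ∷ linked-splice (_ ∷ xs) l l′

unique-suffix : ∀ (xs : List A) → Unique (xs ++ x ∷ ys) → Unique (x ∷ ys)
unique-suffix []       u       = u
unique-suffix (_ ∷ xs) (_ ∷ u) = unique-suffix xs u

unique-splice : ∀ (xs : List A) {x ys zs} → Unique (xs ++ x ∷ ys) → Unique (x ∷ zs) →
                Disjoint xs zs → Unique (xs ++ x ∷ zs)
unique-splice []       _          u  _   = u
unique-splice (w ∷ xs) {zs = zs} (w∉ ∷ u) u′ dis =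
  All.++⁺ (proj₁ w∉-split) (All.head (proj₂ w∉-split) ∷ w∉zs)
  ∷ unique-splice xs u u′ (contractₗ dis)
  where
  w∉-split = All.++⁻ xs w∉
  w∉zs : All (w ≢_) zs
  w∉zs = All.tabulate λ z∈zs w≡z → dis (here refl , subst (_∈ zs) (sym w≡z) z∈zs)

head-splice : ∀ (xs : List A) → head (xs ++ x ∷ ys) ≡ head (xs ++ x ∷ zs)
head-splice []      = refl
head-splice (_ ∷ _) = refl

last-suffix : ∀ (xs : List A) → last (xs ++ x ∷ ys) ≡ last (x ∷ ys)
last-suffix []           = refl
last-suffix (_ ∷ [])     = refl
last-suffix (_ ∷ _ ∷ xs) = last-suffix (_ ∷ xs)

splice-path : ∀ {V : Set} {G : SimpleGraph V} {a b v : V} (P₁ : List V)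
  {P₂ Q₁ Q₂ : List V} →
  IsPath G a b (P₁ ++ v ∷ P₂) → IsPath G a b (Q₁ ++ v ∷ Q₂) →
  Disjoint P₁ Q₂ → IsPath G a b (P₁ ++ v ∷ Q₂)
splice-path P₁ {Q₁ = Q₁} p q dis = record
  { startsAt = trans (head-splice P₁) (IsPath.startsAt p)
  ; endsAt   = trans (last-suffix P₁)
                 (trans (sym (last-suffix Q₁)) (IsPath.endsAt q))
  ; adjacent = linked-splice P₁ (IsPath.adjacent p)
                 (linked-suffix Q₁ (IsPath.adjacent q))
  ; distinct = unique-splice P₁ (IsPath.distinct p)
                 (unique-suffix Q₁ (IsPath.distinct q)) dis
  }

module ShortestPaths {V : Set} (G : SimpleGraph V) (a b : V) where

  SPath : List V → Set
  SPath = IsShortestPath G a b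

  unique : ∀ {P} → SPath P → Unique P
  unique sp = IsPath.distinct (IsShortestPath.isPath sp)

  same-length : ∀ {P Q} → SPath P → SPath Q → length P ≡ length Q
  same-length {P} {Q} sp sq =
    ≤-antisym (IsShortestPath.minimal sp Q (IsShortestPath.isPath sq))
              (IsShortestPath.minimal sq P (IsShortestPath.isPath sp))

  -- Two shortest paths through v, with v strictly earlier on the first.
  -- Such crossings do not exist; `depth` is the induction measure.
  record Crossing : Set where
    constructor crossing
    field
      {v}         : V
      P₁ P₂ Q₁ Q₂ : List V
      first       : SPath (P₁ ++ v ∷ P₂)
      second      : SPath (Q₁ ++ v ∷ Q₂)
      earlier     : length P₁ < length Q₁

  depth : Crossing → ℕ
  depth c = length (Crossing.P₁ c)

  -- If the part of P before v avoids the part of Q after v, the splice is an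
  -- a–b path shorter than the shortest path Q.
  disjoint-crossing-impossible : ∀ {v} P₁ P₂ Q₁ Q₂ →
    SPath (P₁ ++ v ∷ P₂) → SPath (Q₁ ++ v ∷ Q₂) → length P₁ < length Q₁ →
    Disjoint P₁ Q₂ → ⊥
  disjoint-crossing-impossible P₁ P₂ Q₁ Q₂ sp sq P₁<Q₁ dis =
    <⇒≱ (++-shorter P₁ Q₁ P₁<Q₁)
        (IsShortestPath.minimal sq _ (splice-path P₁ (IsShortestPath.isPath sp)
                                                     (IsShortestPath.isPath sq) dis))

  crossing-at-common-vertex : ∀ {v w} P₁ P₂ Q₁ Q₂ →
    SPath (P₁ ++ v ∷ P₂) → SPath (Q₁ ++ v ∷ Q₂) → length P₁ < length Q₁ →
    w ∈ P₁ → w ∈ Q₂ → Σ Crossing λ c → depth c < length P₁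
  crossing-at-common-vertex {v} {w} P₁ P₂ Q₁ Q₂ sp sq P₁<Q₁ w∈P₁ w∈Q₂
    with ∈-∃++ w∈P₁ | ∈-∃++ w∈Q₂
  ... | A , B , refl | C , D , refl =
    crossing A (B ++ v ∷ P₂) (Q₁ ++ v ∷ C) D sp′ sq′ A<Q₁′ , A<P₁
    where
    sp′ : SPath (A ++ w ∷ (B ++ v ∷ P₂))
    sp′ = subst SPath (++-assoc A (w ∷ B) (v ∷ P₂)) sp
    sq′ : SPath ((Q₁ ++ v ∷ C) ++ w ∷ D)
    sq′ = subst SPath (sym (++-assoc Q₁ (v ∷ C) (w ∷ D))) sq
    A<P₁ : length A < length (A ++ w ∷ B)
    A<P₁ = prefix-shorter A
    A<Q₁′ : length A < length (Q₁ ++ v ∷ C)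
    A<Q₁′ = <-≤-trans (<-trans A<P₁ P₁<Q₁) (length-++-≤ˡ Q₁)

  no-crossing-acc : (c : Crossing) → Acc _<_ (depth c) → ⊥
  no-crossing-acc (crossing P₁ P₂ Q₁ Q₂ sp sq P₁<Q₁) (acc smaller) =
    ¬¬-excluded-middle {A = ∃ λ w → w ∈ P₁ × w ∈ Q₂} λ where
      (yes (w , w∈P₁ , w∈Q₂)) →
        let c , c<P₁ = crossing-at-common-vertex P₁ P₂ Q₁ Q₂ sp sq P₁<Q₁ w∈P₁ w∈Q₂
        in  no-crossing-acc c (smaller c<P₁)
      (no no-common) →
        disjoint-crossing-impossible P₁ P₂ Q₁ Q₂ sp sq P₁<Q₁
          λ (w∈P₁ , w∈Q₂) → no-common (_ , w∈P₁ , w∈Q₂)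

  no-crossing : ¬ Crossing
  no-crossing c = no-crossing-acc c (<-wellFounded (depth c))

  -- A vertex common to two shortest a–b paths sits at the same position on
  -- both (namely its distance from a).
  same-position : ∀ {P Q v} → SPath P → SPath Q →
                  at P i ≡ just v → at Q j ≡ just v → i ≡ j
  same-position {P = P} {Q} sp sq eP eQ with split-at P eP | split-at Q eQ
  ... | P₁ , P₂ , refl , refl | Q₁ , Q₂ , refl , refl
    with <-cmp (length P₁) (length Q₁)
  ... | tri< lt _ _ = ⊥-elim (no-crossing (crossing P₁ P₂ Q₁ Q₂ sp sq lt))
  ... | tri≈ _ eq _ = eq
  ... | tri> _ _ gt = ⊥-elim (no-crossing (crossing Q₁ Q₂ P₁ P₂ sq sp gt))

  -- Adjacent vertices of S(G,a,b) differ, as sequences, in exactly one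
  -- position: the position of the vertex of P missing from Q.
  adjacent⇒differs-only-at : ∀ {P Q} → SPath P → SPath Q →
    ExactlyOneOutside P Q → ∃ (DiffersOnlyAt (at P) (at Q))
  adjacent⇒differs-only-at {P} {Q} sp sq (x , (x∈P , x∉Q) , only-x)
    with ∈⇒at x∈P
  ... | i , Pi≡x = i , (λ Pi≡Qi → x∉Q (at⇒∈ Q (trans (sym Pi≡Qi) Pi≡x))) , agree
    where
    agree : AgreeOff (at P) (at Q) i
    agree k k≢i ¬Pk≡Qk with at P k in Pk≡
    ... | nothing = ¬Pk≡Qk (sym (at-beyond P Q (same-length sp sq) Pk≡))
    ... | just z  = ¬¬-excluded-middle {A = z ∈ Q} λ where
      (yes z∈Q) → let l , Ql≡z = ∈⇒at z∈Q
                      k≡l      = same-position sp sq Pk≡ Ql≡z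
                  in  ¬Pk≡Qk (sym (subst (λ m → at Q m ≡ just z) (sym k≡l) Ql≡z))
      (no z∉Q)  → k≢i (at-injective (unique sp)
                        (subst (λ t → at P k ≡ just t) (only-x z (at⇒∈ P Pk≡) z∉Q) Pk≡)
                        Pi≡x)

  agree-off⇒outside : ∀ {P Q} → SPath P → SPath Q →
    AgreeOff (at P) (at Q) i → P ≢ Q → ExactlyOneOutside P Q
  agree-off⇒outside {i} {P} {Q} sp sq ag P≢Q with at P i in Pi≡
  ... | nothing = ⊥-elim (agree-off⇒differs-at P Q ag P≢Q
                             (trans Pi≡ (sym (at-beyond P Q (same-length sp sq) Pi≡))))
  ... | just x  = x , (at⇒∈ P Pi≡ , x∉Q) , only-x
    where
    Pi≢Qi = agree-off⇒differs-at P Q ag P≢Q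
    x∉Q : x ∉ Q
    x∉Q x∈Q with ∈⇒at x∈Q
    ... | k , Qk≡x with k ≟ i
    ...   | yes refl = Pi≢Qi (trans Pi≡ (sym Qk≡x))
    ...   | no  k≢i  = ag k k≢i λ Pk≡Qk →
                         k≢i (at-injective (unique sp) (trans Pk≡Qk Qk≡x) Pi≡)
    only-x : ∀ y → y ∈ P → y ∉ Q → y ≡ x
    only-x y y∈P y∉Q with ∈⇒at y∈P
    ... | k , Pk≡y with k ≟ i
    ...   | yes refl = just-injective (trans (sym Pk≡y) Pi≡)
    ...   | no  k≢i  = ⊥-elim (ag k k≢i λ Pk≡Qk →
                         y∉Q (at⇒∈ Q (trans (sym Pk≡Qk) Pk≡y)))

  agree-off⇒adjacent : ∀ {P Q} → SPath P → SPath Q →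
    AgreeOff (at P) (at Q) i → P ≢ Q → DifferInOneVertex P Q
  agree-off⇒adjacent sp sq ag P≢Q =
    agree-off⇒outside sp sq ag P≢Q ,
    agree-off⇒outside sq sp (agree-sym ag) (λ Q≡P → P≢Q (sym Q≡P))

  -- In an induced K₄ − e the common neighbours u₃, u₄ of the edge u₁u₂ both
  -- differ from u₁ exactly where u₂ does, which makes them adjacent.
  k4-e-free : SPGraphK4-eFree G a b
  k4-e-free (P₁ , s₁) (P₂ , s₂) (P₃ , s₃) (P₄ , s₄) K
    with adjacent⇒differs-only-at s₁ s₂ (proj₁ e12)
       | adjacent⇒differs-only-at s₁ s₃ (proj₁ e13)
       | adjacent⇒differs-only-at s₂ s₃ (proj₁ e23)
       | adjacent⇒differs-only-at s₁ s₄ (proj₁ e14)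
       | adjacent⇒differs-only-at s₂ s₄ (proj₁ e24)
    where open InducedK4-e K
  ... | i , D₁₂ | _ , D₁₃ | _ , D₂₃ | _ , D₁₄ | _ , D₂₄
    with triangle-same-position D₁₂ D₁₃ D₂₃ | triangle-same-position D₁₂ D₁₄ D₂₄
  ... | refl | refl =
    n34 (agree-off⇒adjacent s₃ s₄ (agree-through (proj₂ D₁₃) (proj₂ D₁₄)) d34)
    where open InducedK4-e K

corollary8 : {V : Set} (G : SimpleGraph V) (a b : V) → a ≢ b →
    SPGraphK4-eFree G a b
corollary8 G a b _ = ShortestPaths.k4-e-free G a b
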